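{- Let $X$ be a permutation of $[n]$ avoiding $(2,3,1)$, $T$ an initial tree and $G(X)=G_T(X)$. Then there are no keys $a<b<c$ and times $t_1<t_2$ with $(a,t_2),(c,t_2),(b,t_1)\in BL$. Therefore $|BL|=O(n)$.
   Context: $X=(x_1,\dots,x_n)$ is identified with the point set $\{(x_t,t)\}$. Geometric Greedy $G_T(X)$: the initial BST $T$ is encoded by a fixed point set in rows $-(n-1),\dots,0$ (standard geometric encoding); for $t=1,\dots,n$, with $p=(x_t,t)$ and, for each key $a$, $q=(a,\tau(a,t))$ where $\tau(a,t)$ is the last row $<t$ with a point in column $a$, add $(a,t)$ iff the closed rectangle with corners $p,q$ contains no other point; $G_T(X)$ is the set of points added in rows $1,\dots,n$. For $q\in G(X)\setminus X$ let $p_1\in X$ be the unique input point with $p_1.x=q.x$ and $p_2\in X$ the unique input point with $p_2.y=q.y$. $q\in B$ if $p_1.y<q.y$, $q\in T$ otherwise; $q\in R$ if $p_2.x>q.x$, $q\in L$ if $p_2.x<q.x$. $BR=B\cap R$, $BL=B\cap L$, $TR=T\cap R$, $TL=T\cap L$. -}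

module Defs where

open import Data.Nat using (ℕ; zero; suc; _+_; _*_; _∸_; _⊓_; _⊔_; _≤ᵇ_; _≡ᵇ_; _<?_)
open import Data.Bool using (Bool; true; false; _∧_; _∨_; not; if_then_else_)
open import Data.Fin using (Fin; toℕ; fromℕ<) renaming (_<_ to _<ꟳ_)
open import Data.Fin.Permutation using (Permutation′; _⟨$⟩ʳ_; _⟨$⟩ˡ_)
open import Data.Bool.ListAction using (any)
open import Data.List using (List; upTo; allFin; length; filterᵇ; cartesianProduct)
open import Data.Maybe using (Maybe; just; nothing)
open import Data.Product using (_×_; _,_)
open import Relation.Nullary using (¬_; yes; no)
open import Relation.Binary.PropositionalEquality using (_≡_)

-- Conventions
--  * keys [n] = {1,…,n} are represented by Fin n (key k ↦ k-1, order-preserving)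
--  * times 1,…,n are represented by Fin n (time t ↦ t-1)
--  * X = (x_1,…,x_n) is a permutation π : Permutation′ n, x_{i+1} = π ⟨$⟩ʳ i
--  * rows (y-coordinates) are shifted by +n so they are naturals:
--      row r (paper)  ↦  r + n   (initial rows -(n-1)…0 ↦ 1…n,
--                                 input rows 1…n       ↦ n+1…2n)

-- Binary search trees on the contiguous key set {lo,…,hi-1}

data BST : ℕ → ℕ → Set where
  leaf : ∀ {k} → BST k k
  node : ∀ {lo hi} (k : ℕ) → BST lo k → BST (suc k) hi → BST lo hi

depth : ∀ {lo hi} → BST lo hi → ℕ → ℕ
depth leaf         key = 0
depth (node k l r) key =
  if key Data.Nat.<ᵇ k then suc (depth l key)
  else (if key ≡ᵇ k then 0 else suc (depth r key))

InitTree : ℕ → Set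
InitTree n = BST 0 n

-- Point sets: column (key) ↦ shifted row ↦ present?

Pts : ℕ → Set
Pts n = Fin n → ℕ → Bool

-- standard geometric encoding of the initial tree:
-- key a gets the point at paper-row -depth(a), i.e. shifted row n ∸ depth(a)
initPts : ∀ {n} → InitTree n → Pts n
initPts {n} T a r = r ≡ᵇ (n ∸ depth T (toℕ a))

-- last row strictly below ρ with a point (0 if none; row 0 is never used)
lastBelow : (ℕ → Bool) → ℕ → ℕ
lastBelow f zero    = 0
lastBelow f (suc ρ) = if f ρ then ρ else lastBelow f ρ

betweenᵇ : ℕ → ℕ → ℕ → Bool
betweenᵇ a b c = ((a ⊓ b) ≤ᵇ c) ∧ (c ≤ᵇ (a ⊔ b))

-- Given the points P of all rows < ρ, the input point p = (x, ρ) and a key a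
-- with q = (a, τ(a,ρ)): does the closed rectangle with corners p, q contain a
-- point other than p and q?  (all points of P lie in rows < ρ, so p is not
-- among them, and p is the only point of row ρ considered.)
otherPointInRect : ∀ {n} → Pts n → Fin n → ℕ → Fin n → Bool
otherPointInRect {n} P x ρ a =
  any (λ c → any (λ r → P c r
                       ∧ betweenᵇ (toℕ x) (toℕ a) (toℕ c)
                       ∧ (τ ≤ᵇ r)
                       ∧ not ((toℕ c ≡ᵇ toℕ a) ∧ (r ≡ᵇ τ)))
                 (upTo ρ))
      (allFin n)
  where τ = lastBelow (P a) ρ

keyAt : ∀ {n} → Permutation′ n → ℕ → Maybe (Fin n)
keyAt {n} π t with t <? n
... | yes t<n = just (π ⟨$⟩ʳ fromℕ< t<n)
... | no  _   = nothing

-- Geometric Greedy: greedyStage π T t = all points in paper-rows ≤ t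
greedyStage : ∀ {n} → Permutation′ n → InitTree n → ℕ → Pts n
greedyStage     π T zero    = initPts T
greedyStage {n} π T (suc t) a r =
  greedyStage π T t a r ∨ ((r ≡ᵇ (n + suc t)) ∧ added (keyAt π t))
  where
    added : Maybe (Fin n) → Bool
    added nothing  = false
    added (just x) = not (otherPointInRect (greedyStage π T t) x (n + suc t) a)

-- (a, t+1) ∈ G_T(X), for key a and 0-based time index t
inGᵇ : ∀ {n} → Permutation′ n → InitTree n → Fin n → Fin n → Bool
inGᵇ {n} π T a t = greedyStage π T n a (n + suc (toℕ t))

-- For q = (a, t) ∈ G(X) \ X:
--   p₁ = input point of column a, at time π⁻¹(a);  q ∈ B iff π⁻¹(a) < t
--   p₂ = input point of row t, at key π(t);        q ∈ L iff π(t) < a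
-- (π(t) < a already forces q ∉ X.)

isBLᵇ : ∀ {n} → Permutation′ n → InitTree n → Fin n → Fin n → Bool
isBLᵇ π T a t =
  inGᵇ π T a t
  ∧ (suc (toℕ (π ⟨$⟩ˡ a)) ≤ᵇ toℕ t)
  ∧ (suc (toℕ (π ⟨$⟩ʳ t)) ≤ᵇ toℕ a)

InBL : ∀ {n} → Permutation′ n → InitTree n → Fin n → Fin n → Set
InBL π T a t = isBLᵇ π T a t ≡ true

sizeBL : ∀ {n} → Permutation′ n → InitTree n → ℕ
sizeBL {n} π T =
  length (filterᵇ (λ { (a , t) → isBLᵇ π T a t })
                  (cartesianProduct (allFin n) (allFin n)))

Avoids231 : ∀ {n} → Permutation′ n → Set
Avoids231 π = ∀ i j k → i <ꟳ j → j <ꟳ k →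
  ¬ ((π ⟨$⟩ʳ k) <ꟳ (π ⟨$⟩ʳ i) × (π ⟨$⟩ʳ i) <ꟳ (π ⟨$⟩ʳ j))

{-# OPTIONS --safe #-}
-- In a 231-avoiding input every row of G(X) contains at most one point of BL;
-- both claims follow, the bound |BL| ≤ n by counting rows.
-- Suppose (a,t) and (c,t) lie in BL with a < c, and let u be the last row
-- below t with a point in column a; u lies at or above the access of a.
-- No row s with u < s ≤ t has a point in column c: the key x_s accessed in
-- row s satisfies x_s ≤ a (otherwise the accesses of a, x_s, x_t form a 231
-- pattern), so either the previous point of column c lies above u, and we
-- descend to it, or the rectangle spanned by (x_s,s) and that previous point
-- contains (a,u), so Greedy would not have added (c,s).
module Submission where

open import Defs
open import Data.Nat
open import Data.Nat.Properties
open import Data.Nat.Induction using (<-rec)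
open import Data.Bool using (Bool; true; false; _∧_; _∨_; not; T; T?)
open import Data.Bool.Properties using (T-∧; T-≡; T-not-≡; ∨-identityʳ)
open import Data.Bool.ListAction using (any)
open import Data.Empty using (⊥; ⊥-elim)
open import Data.Sum using (inj₁; inj₂)
open import Data.Fin using (Fin; zero; suc; toℕ; fromℕ<) renaming (_<_ to _<ꟳ_; _≤_ to _≤ꟳ_)
open import Data.Fin.Properties as Finₚ using (toℕ-injective; toℕ-fromℕ<; fromℕ<-toℕ; toℕ<n; pigeonhole)
open import Data.Fin.Permutation using (Permutation′; _⟨$⟩ʳ_; _⟨$⟩ˡ_; inverseʳ)
open import Data.List using (length; lookup; upTo; allFin; filterᵇ; cartesianProduct)
open import Data.List.Membership.Propositional using (find; lose)
open import Data.List.Membership.Propositional.Properties using (∈-upTo⁺; ∈-upTo⁻; ∈-allFin; ∈-lookup)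
open import Data.List.Relation.Unary.All as All using (All; []; _∷_)
open import Data.List.Relation.Unary.All.Properties using (all-filter)
open import Data.List.Relation.Unary.AllPairs as AllPairs using (AllPairs; []; _∷_)
open import Data.List.Relation.Unary.AllPairs.Properties as AllPairsₚ using ()
open import Data.List.Relation.Unary.Any.Properties using (any⁺; any⁻)
open import Data.List.Relation.Unary.Unique.Propositional.Properties using (cartesianProduct⁺; allFin⁺)
open import Data.Product using (_×_; _,_; proj₁; proj₂; Σ; ∃; ∃₂)
open import Function using (_∘_; _on_)
open import Function.Bundles using (Equivalence)
open import Level using (0ℓ)
open import Relation.Binary.Core using (Rel)
open import Relation.Binary.Definitions using (tri<; tri≈; tri>)
open import Relation.Binary.PropositionalEquality
open import Relation.Nullary using (¬_; yes; no; contradiction)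

T-not⁺ : ∀ {b} → ¬ T b → T (not b)
T-not⁺ {false} _   = _
T-not⁺ {true}  ¬tb = ¬tb _

T-not⁻ : ∀ {b} → T (not b) → ¬ T b
T-not⁻ {false} _ ()

T-∧⁺ : ∀ {b c} → T b → T c → T (b ∧ c)
T-∧⁺ tb tc = Equivalence.from T-∧ (tb , tc)

T-∧⁻ : ∀ {b c} → T (b ∧ c) → T b × T c
T-∧⁻ = Equivalence.to T-∧

∨-false∧ : ∀ x {y z} → y ≡ false → x ∨ (y ∧ z) ≡ x
∨-false∧ x refl = ∨-identityʳ x

≢⇒≡ᵇ-false : ∀ {m k} → m ≢ k → (m ≡ᵇ k) ≡ false
≢⇒≡ᵇ-false m≢k = Equivalence.to T-not-≡ (T-not⁺ (m≢k ∘ ≡ᵇ⇒≡ _ _))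

AllPairs-lookup : ∀ {A : Set} {R : Rel A 0ℓ} {xs} → AllPairs R xs →
                  ∀ {i j} → i <ꟳ j → R (lookup xs i) (lookup xs j)
AllPairs-lookup (Rx ∷ _)   {zero}  {suc j} _   = All.lookup Rx (∈-lookup j)
AllPairs-lookup (_  ∷ Rxs) {suc i} {suc j} i<j = AllPairs-lookup Rxs (s<s⁻¹ i<j)

AllPairs-≢-on⇒length≤ : ∀ {A : Set} {n} (g : A → Fin n) {xs} →
                        AllPairs (_≢_ on g) xs → length xs ≤ n
AllPairs-≢-on⇒length≤ g {xs} distinct = ≮⇒≥ λ n<len →
  let i , j , i<j , gᵢ≡gⱼ = pigeonhole n<len (g ∘ lookup xs)
  in AllPairs-lookup distinct i<j gᵢ≡gⱼ

AllPairs-restrict : ∀ {A : Set} {P : A → Set} {R : Rel A 0ℓ} {xs} →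
  All P xs → AllPairs (λ x y → P x → P y → R x y) xs → AllPairs R xs
AllPairs-restrict []         []       = []
AllPairs-restrict (px ∷ pxs) (h ∷ hs) =
  All.zipWith (λ (py , Rxy) → Rxy px py) (pxs , h) ∷ AllPairs-restrict pxs hs

filterᵇ-grid-length≤ : ∀ {n} (f : Fin n × Fin n → Bool) →
  (∀ {a c t} → T (f (a , t)) → T (f (c , t)) → a ≡ c) →
  length (filterᵇ f (cartesianProduct (allFin n) (allFin n))) ≤ n
filterᵇ-grid-length≤ {n} f columnUnique = AllPairs-≢-on⇒length≤ proj₂
  (AllPairs-restrict (all-filter (T? ∘ f) grid)
    (AllPairsₚ.filter⁺ (T? ∘ f)
      (AllPairs.map rowsDiffer (cartesianProduct⁺ (allFin⁺ n) (allFin⁺ n)))))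
  where
  grid = cartesianProduct (allFin n) (allFin n)
  rowsDiffer : ∀ {p q} → p ≢ q → T (f p) → T (f q) → proj₂ p ≢ proj₂ q
  rowsDiffer {a , t} {c , .t} p≢q fp fq refl = p≢q (cong (_, t) (columnUnique fp fq))

lastBelow-maximal : ∀ (f : ℕ → Bool) {ρ r} → T (f r) → r < ρ → r ≤ lastBelow f ρ
lastBelow-maximal f {suc ρ} {r} fr r<1+ρ with f ρ in eq
... | true = s≤s⁻¹ r<1+ρ
... | false with r ≟ ρ
...   | yes refl = contradiction (subst T eq fr) (λ ())
...   | no r≢ρ = lastBelow-maximal f fr (≤∧≢⇒< (s≤s⁻¹ r<1+ρ) r≢ρ)

lastBelow-hit : ∀ (f : ℕ → Bool) ρ → 0 < lastBelow f ρ →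
                T (f (lastBelow f ρ)) × lastBelow f ρ < ρ
lastBelow-hit f (suc ρ) pos with f ρ in eq
... | true  = subst T (sym eq) _ , n<1+n ρ
... | false with lastBelow-hit f ρ pos
...   | hit , below = hit , m<n⇒m<1+n below

lastBelow-cong : ∀ {f g : ℕ → Bool} ρ → (∀ {r} → r < ρ → f r ≡ g r) →
                 lastBelow f ρ ≡ lastBelow g ρ
lastBelow-cong zero    f≗g = refl
lastBelow-cong {g = g} (suc ρ) f≗g rewrite f≗g (n<1+n ρ) with g ρ
... | true  = refl
... | false = lastBelow-cong ρ (f≗g ∘ m<n⇒m<1+n)

betweenᵇ-≤ : ∀ {a b c} → a ≤ c → c ≤ b → T (betweenᵇ a b c)
betweenᵇ-≤ {a} {b} {c} a≤c c≤b
  rewrite m≤n⇒m⊓n≡m (≤-trans a≤c c≤b) | m≤n⇒m⊔n≡n (≤-trans a≤c c≤b)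
  = T-∧⁺ (≤⇒≤ᵇ a≤c) (≤⇒≤ᵇ c≤b)

betweenᵇ-same : ∀ a c → T (betweenᵇ a a c) → c ≡ a
betweenᵇ-same a c h rewrite ⊓-idem a | ⊔-idem a with T-∧⁻ h
... | a≤c , c≤a = ≤-antisym (≤ᵇ⇒≤ c a c≤a) (≤ᵇ⇒≤ a c a≤c)

module _ {n} (P : Pts n) (x : Fin n) (ρ : ℕ) where

  otherPointInRect⁺ : ∀ {a c r} → r < ρ → T (P c r) → T (betweenᵇ (toℕ x) (toℕ a) (toℕ c)) →
                      lastBelow (P a) ρ ≤ r → toℕ c ≢ toℕ a → T (otherPointInRect P x ρ a)
  otherPointInRect⁺ {c = c} r<ρ Pcr x≤c≤a τ≤r c≢a =
    any⁺ _ (lose (∈-allFin c) (any⁺ _ (lose (∈-upTo⁺ r<ρ)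
      (T-∧⁺ Pcr (T-∧⁺ x≤c≤a (T-∧⁺ (≤⇒≤ᵇ τ≤r)
        (T-not⁺ (c≢a ∘ ≡ᵇ⇒≡ _ _ ∘ proj₁ ∘ T-∧⁻))))))))

  otherPointInRect⁻ : ∀ {a} → T (otherPointInRect P x ρ a) →
    ∃₂ λ c r → r < ρ × T (P c r) × T (betweenᵇ (toℕ x) (toℕ a) (toℕ c)) ×
               lastBelow (P a) ρ ≤ r × ¬ (toℕ c ≡ toℕ a × r ≡ lastBelow (P a) ρ)
  otherPointInRect⁻ {a} h
    with c , _ , hc ← find (any⁻ (λ c → any _ (upTo ρ)) (allFin n) h)
    with r , r∈ρ , hr ← find (any⁻ _ _ hc)
    with Pcr , hr ← T-∧⁻ hr
    with x≤c≤a , hr ← T-∧⁻ hr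
    with τ≤r , distinct ← T-∧⁻ hr
    = c , r , ∈-upTo⁻ r∈ρ , Pcr , x≤c≤a , ≤ᵇ⇒≤ τ r τ≤r ,
      λ (c≡a , r≡τ) → T-not⁻ distinct (T-∧⁺ (≡⇒≡ᵇ _ _ c≡a) (≡⇒≡ᵇ _ _ r≡τ))
    where τ = lastBelow (P a) ρ

  otherPointInRect-self : ¬ T (otherPointInRect P x ρ x)
  otherPointInRect-self h
    with c , r , r<ρ , Pcr , x≤c≤x , τ≤r , distinct ← otherPointInRect⁻ h
    with refl ← toℕ-injective (betweenᵇ-same (toℕ x) (toℕ c) x≤c≤x)
    = distinct (refl , ≤-antisym (lastBelow-maximal (P x) Pcr r<ρ) τ≤r)

  otherPointInRect-empty : ∀ {a c r} → ¬ T (otherPointInRect P x ρ a) →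
    T (betweenᵇ (toℕ x) (toℕ a) (toℕ c)) → lastBelow (P a) ρ ≤ r → r < ρ → T (P c r) → c ≡ a
  otherPointInRect-empty {a} {c} empty x≤c≤a τ≤r r<ρ Pcr with toℕ c ≟ toℕ a
  ... | yes c≡a = toℕ-injective c≡a
  ... | no  c≢a = contradiction (otherPointInRect⁺ r<ρ Pcr x≤c≤a τ≤r c≢a) empty

Avoids231-keysBetween≤ : ∀ {n} {π : Permutation′ n} → Avoids231 π → ∀ {a s t} →
  π ⟨$⟩ˡ a <ꟳ s → s ≤ꟳ t → π ⟨$⟩ʳ t <ꟳ a → π ⟨$⟩ʳ s ≤ꟳ a
Avoids231-keysBetween≤ {π = π} avoids {a} {s} {t} i<s s≤t xₜ<a with m≤n⇒m<n∨m≡n s≤t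
... | inj₂ s≡t rewrite toℕ-injective s≡t = <⇒≤ xₜ<a
... | inj₁ s<t = ≮⇒≥ λ a<xₛ → avoids (π ⟨$⟩ˡ a) s t i<s s<t
      (subst (π ⟨$⟩ʳ t <ꟳ_) (sym (inverseʳ π)) xₜ<a , subst (_<ꟳ π ⟨$⟩ʳ s) (sym (inverseʳ π)) a<xₛ)

module Greedy {n} (π : Permutation′ n) (Tr : InitTree n) where

  G : ℕ → Pts n
  G = greedyStage π Tr

  Gf : Pts n
  Gf = G n

  row : Fin n → ℕ
  row t = n + suc (toℕ t)

  G-suc-offRow : ∀ {t a r} → r ≢ n + suc t → G (suc t) a r ≡ G t a r
  G-suc-offRow {t} {a} {r} r≢ = ∨-false∧ (G t a r) (≢⇒≡ᵇ-false r≢)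

  G-above : ∀ t {a r} → n + t < r → G t a r ≡ false
  G-above zero {a} {r} n+0<r = ≢⇒≡ᵇ-false λ r≡ →
    <⇒≢ (≤-<-trans (m∸n≤m n (depth Tr (toℕ a))) (subst (_< r) (+-identityʳ n) n+0<r)) (sym r≡)
  G-above (suc t) n+1+t<r =
    trans (G-suc-offRow (>⇒≢ n+1+t<r)) (G-above t (<-trans (+-monoʳ-< n (n<1+n t)) n+1+t<r))

  G-extend : ∀ m {t a r} → r ≤ n + t → G (m + t) a r ≡ G t a r
  G-extend zero    r≤ = refl
  G-extend (suc m) {t} r≤ =
    trans (G-suc-offRow (<⇒≢ (≤-<-trans r≤ (+-monoʳ-< n (s≤s (m≤n+m t m)))))) (G-extend m r≤)

  Gf-agrees : ∀ {t a r} → t ≤ n → r ≤ n + t → Gf a r ≡ G t a r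
  Gf-agrees {t} {a} {r} t≤n r≤ =
    trans (cong (λ k → G k a r) (sym (m∸n+n≡m t≤n))) (G-extend (n ∸ t) r≤)

  G-step : ∀ {t} a r (t<n : t < n) → G (suc t) a r ≡
    G t a r ∨ ((r ≡ᵇ n + suc t) ∧ not (otherPointInRect (G t) (π ⟨$⟩ʳ fromℕ< t<n) (n + suc t) a))
  G-step {t} a r t<n with t <? n
  ... | yes _   = refl
  ... | no  t≮n = contradiction t<n t≮n

  Gf-row : ∀ s a → Gf a (row s) ≡ not (otherPointInRect (G (toℕ s)) (π ⟨$⟩ʳ s) (row s) a)
  Gf-row s a = begin
    Gf a (row s)                                  ≡⟨ Gf-agrees (toℕ<n s) ≤-refl ⟩
    G (suc t) a (row s)                           ≡⟨ G-step a (row s) (toℕ<n s) ⟩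
    G t a (row s) ∨ ((row s ≡ᵇ row s) ∧ added)    ≡⟨ cong₂ (λ b b′ → b ∨ (b′ ∧ added))
                                                       (G-above t (+-monoʳ-< n (n<1+n t)))
                                                       (Equivalence.to T-≡ (≡⇒≡ᵇ (row s) _ refl)) ⟩
    added                                         ≡⟨ cong (λ i → not (otherPointInRect (G t) (π ⟨$⟩ʳ i) (row s) a))
                                                       (fromℕ<-toℕ s (toℕ<n s)) ⟩
    not (otherPointInRect (G t) (π ⟨$⟩ʳ s) (row s) a) ∎
    where
    open ≡-Reasoning
    t = toℕ s
    added = not (otherPointInRect (G t) (π ⟨$⟩ʳ fromℕ< (toℕ<n s)) (row s) a)

  Gf-below : ∀ s {a r} → r < row s → G (toℕ s) a r ≡ Gf a r
  Gf-below s {r = r} r<row =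
    sym (Gf-agrees (<⇒≤ (toℕ<n s)) (s≤s⁻¹ (subst (r <_) (+-suc n (toℕ s)) r<row)))

  input∈Gf : ∀ s → T (Gf (π ⟨$⟩ʳ s) (row s))
  input∈Gf s =
    subst T (sym (Gf-row s _)) (T-not⁺ (otherPointInRect-self (G (toℕ s)) (π ⟨$⟩ʳ s) (row s)))

  Gf-rectEmpty : ∀ s {a c r} → T (Gf a (row s)) →
    toℕ (π ⟨$⟩ʳ s) ≤ toℕ c → toℕ c ≤ toℕ a →
    lastBelow (Gf a) (row s) ≤ r → r < row s → T (Gf c r) → c ≡ a
  Gf-rectEmpty s {a} a∈G x≤c c≤a τ≤r r<row c∈G =
    otherPointInRect-empty (G (toℕ s)) (π ⟨$⟩ʳ s) (row s)
      (T-not⁻ (subst T (Gf-row s a) a∈G))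
      (betweenᵇ-≤ x≤c c≤a)
      (subst (_≤ _) (sym (lastBelow-cong (row s) (Gf-below s))) τ≤r)
      r<row
      (subst T (sym (Gf-below s r<row)) c∈G)

  record BLPoint (a t : Fin n) : Set where
    field
      inG   : T (Gf a (row t))
      below : π ⟨$⟩ˡ a <ꟳ t
      left  : π ⟨$⟩ʳ t <ꟳ a

  InBL⇒BLPoint : ∀ {a t} → InBL π Tr a t → BLPoint a t
  InBL⇒BLPoint bl
    with inG , rest ← T-∧⁻ (Equivalence.from T-≡ bl)
    with below , left ← T-∧⁻ rest
    = record { inG = inG ; below = ≤ᵇ⇒≤ _ _ below ; left = ≤ᵇ⇒≤ _ _ left }

  row-cancel-≤ : ∀ {s t} → row s ≤ row t → s ≤ꟳ t
  row-cancel-≤ = s≤s⁻¹ ∘ +-cancelˡ-≤ n _ _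

  row-cancel-< : ∀ {s t} → row s < row t → s <ꟳ t
  row-cancel-< = s<s⁻¹ ∘ +-cancelˡ-< n _ _

  row-surjective : ∀ {r} t → n < r → r ≤ row t → ∃ λ s → row s ≡ r
  row-surjective {r} t n<r r≤row = fromℕ< k<n , trans (cong (λ i → n + suc i) (toℕ-fromℕ< k<n)) r≡
    where
    k = r ∸ suc n
    r≡ : n + suc k ≡ r
    r≡ = trans (+-suc n k) (m+[n∸m]≡n n<r)
    k<n : k < n
    k<n = ≤-<-trans (s≤s⁻¹ (+-cancelˡ-≤ n _ _ (subst (_≤ row t) (sym r≡) r≤row))) (toℕ<n t)

  ¬BL-pair-in-row : Avoids231 π → ∀ {a c t} → a <ꟳ c → InBL π Tr a t → InBL π Tr c t → ⊥
  ¬BL-pair-in-row avoids {a} {c} {t} a<c a∈BL c∈BL =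
    noPointAbove (row t) (BLPoint.inG (InBL⇒BLPoint c∈BL)) (proj₂ u-hit) ≤-refl
    where
    open BLPoint (InBL⇒BLPoint a∈BL)
    i = π ⟨$⟩ˡ a
    u = lastBelow (Gf a) (row t)

    row-i≤u : row i ≤ u
    row-i≤u = lastBelow-maximal (Gf a)
      (subst (λ k → T (Gf k (row i))) (inverseʳ π) (input∈Gf i))
      (+-monoʳ-< n (s<s below))

    n<u : n < u
    n<u = <-≤-trans (m<m+n n z<s) row-i≤u

    u-hit : T (Gf a u) × u < row t
    u-hit = lastBelow-hit (Gf a) (row t) (≤-<-trans z≤n n<u)

    NoPoint : ℕ → Set
    NoPoint r = T (Gf c r) → u < r → r ≤ row t → ⊥

    noPointAt : ∀ r → (∀ {r′} → r′ < r → NoPoint r′) → NoPoint r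
    noPointAt r rec c∈G u<r r≤row with row-surjective t (<-trans n<u u<r) r≤row
    ... | s , refl with u <? lastBelow (Gf c) (row s)
    ...   | yes u<w = rec w<row (proj₁ w-hit) u<w (<⇒≤ (<-≤-trans w<row r≤row))
      where
      w-hit = lastBelow-hit (Gf c) (row s) (≤-<-trans z≤n u<w)
      w<row = proj₂ w-hit
    ...   | no  u≮w =
      <⇒≢ a<c (cong toℕ (Gf-rectEmpty s c∈G xₛ≤a (<⇒≤ a<c) (≮⇒≥ u≮w) u<r (proj₁ u-hit)))
      where
      xₛ≤a : π ⟨$⟩ʳ s ≤ꟳ a
      xₛ≤a = Avoids231-keysBetween≤ {π = π} avoids
        (row-cancel-< (≤-<-trans row-i≤u u<r)) (row-cancel-≤ r≤row) left

    noPointAbove : ∀ r → NoPoint r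
    noPointAbove = <-rec NoPoint noPointAt

  BL-column-unique : Avoids231 π → ∀ {a c t} → InBL π Tr a t → InBL π Tr c t → a ≡ c
  BL-column-unique avoids {a} {c} a∈BL c∈BL with Finₚ.<-cmp a c
  ... | tri< a<c _ _ = ⊥-elim (¬BL-pair-in-row avoids a<c a∈BL c∈BL)
  ... | tri≈ _ a≡c _ = a≡c
  ... | tri> _ _ c<a = ⊥-elim (¬BL-pair-in-row avoids c<a c∈BL a∈BL)

  sizeBL≤n : Avoids231 π → sizeBL π Tr ≤ n
  sizeBL≤n avoids = filterᵇ-grid-length≤ _ λ a∈BL c∈BL →
    BL-column-unique avoids (Equivalence.to T-≡ a∈BL) (Equivalence.to T-≡ c∈BL)

mainTheorem17 :
    (∀ (n : ℕ) (π : Permutation′ n) (T : InitTree n) → Avoids231 π →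
       ∀ (a b c t₁ t₂ : Fin n) → a <ꟳ b → b <ꟳ c → t₁ <ꟳ t₂ →
       ¬ (InBL π T a t₂ × InBL π T c t₂ × InBL π T b t₁))
    ×
    Σ ℕ (λ C → ∀ (n : ℕ) (π : Permutation′ n) (T : InitTree n) → Avoids231 π →
       sizeBL π T ≤ C * n)
mainTheorem17 =
  (λ n π T avoids a b c t₁ t₂ a<b b<c _ (a∈BL , c∈BL , _) →
     Greedy.¬BL-pair-in-row π T avoids (<-trans a<b b<c) a∈BL c∈BL) ,
  (1 , λ n π T avoids →
     ≤-trans (Greedy.sizeBL≤n π T avoids) (≤-reflexive (sym (*-identityˡ n))))
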